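{- Let $k\geq 3$. Let $C$ and $C'$ be cycles of length $2k$ such that $E(C)\cap E(C')=\emptyset$ and $V(C)\cap V(C')\neq\emptyset$. If $H:=C\cup C'$ has girth at least $2k-2$, then $H$ can be decomposed into two paths of length $2k$.
   Context: Length means number of edges; girth is the length of a shortest cycle. A decomposition of $H$ is a set of subgraphs whose edge sets partition $E(H)$. -}

module Defs where

open import Data.Nat using (ℕ; zero; suc; _+_; _*_; _∸_; _≤_; _<_)
open import Data.Nat.DivMod using (_%_; m%n<n)
open import Data.Fin using (Fin; toℕ; fromℕ<; inject₁) renaming (suc to fsuc)
open import Data.Product using (Σ; ∃; _×_; _,_)
open import Data.Sum using (_⊎_)
open import Data.Empty using (⊥)
open import Relation.Nullary using (¬_)
open import Relation.Binary.PropositionalEquality using (_≡_)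
open import Function.Definitions using (Injective)

-- Vertices are natural numbers. A graph is given by its (symmetric) edge
-- relation on ordered pairs of vertices: E x y means {x,y} is an edge.
EdgeRel : Set₁
EdgeRel = ℕ → ℕ → Set

next : {n : ℕ} → Fin n → Fin n
next {suc m} i = fromℕ< (m%n<n (suc (toℕ i)) (suc m))

record Cycle (n : ℕ) : Set where
  field
    3≤n  : 3 ≤ n
    vtx  : Fin n → ℕ
    inj  : Injective _≡_ _≡_ vtx
open Cycle public

CycleEdge : {n : ℕ} → Cycle n → EdgeRel
CycleEdge C x y = ∃ λ i →
  (vtx C i ≡ x × vtx C (next i) ≡ y) ⊎ (vtx C i ≡ y × vtx C (next i) ≡ x)

CycleVertex : {n : ℕ} → Cycle n → ℕ → Set
CycleVertex C x = ∃ λ i → vtx C i ≡ x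

record Path (n : ℕ) : Set where
  field
    pvtx : Fin (suc n) → ℕ
    pinj : Injective _≡_ _≡_ pvtx
open Path public

PathEdge : {n : ℕ} → Path n → EdgeRel
PathEdge P x y = ∃ λ (i : Fin _) →
  (pvtx P (inject₁ i) ≡ x × pvtx P (fsuc i) ≡ y)
  ⊎ (pvtx P (inject₁ i) ≡ y × pvtx P (fsuc i) ≡ x)

_∪E_ : EdgeRel → EdgeRel → EdgeRel
(E ∪E F) x y = E x y ⊎ F x y

CycleIn : EdgeRel → {m : ℕ} → Cycle m → Set
CycleIn E C = ∀ x y → CycleEdge C x y → E x y

GirthAtLeast : EdgeRel → ℕ → Set
GirthAtLeast E g = ∀ m (D : Cycle m) → CycleIn E D → g ≤ m

DecomposesInto : EdgeRel → {n : ℕ} → Path n → Path n → Set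
DecomposesInto E P Q =
  (∀ x y → E x y → PathEdge P x y ⊎ PathEdge Q x y)
  × (∀ x y → PathEdge P x y → E x y)
  × (∀ x y → PathEdge Q x y → E x y)
  × (∀ x y → PathEdge P x y → PathEdge Q x y → ⊥)

-- Let v be a common vertex of C and C′. An edge vw of C whose end w lies on C′,
-- say at distance p from v along C′, is a chord of C′ (it is not an edge of C′),
-- and it closes the two arcs of C′ between v and w into cycles of lengths p + 1
-- and 2k − p + 1. The girth bound then gives 2k − 3 ≤ p ≤ 3, so both neighbours
-- of v on C would have to be the same vertex of C′; hence v has a neighbour a on C
-- outside C′ and, symmetrically, a neighbour c on C′ outside C. Replacing the edge
-- va of C by vc and the edge vc of C′ by va opens both cycles into paths of
-- length 2k that partition the edges of C ∪ C′.
module Submission where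

open import Defs
open import Data.Nat using (ℕ; zero; suc; pred; _+_; _*_; _∸_; _≤_; _<_; z≤n; s≤s; s≤s⁻¹; _≟_)
open import Data.Nat.Properties
open import Data.Nat.DivMod
open import Data.Fin using (Fin; toℕ; fromℕ<)
open import Data.Fin.Properties using (toℕ-fromℕ<; fromℕ<-cong; toℕ-injective; toℕ<n; toℕ-inject₁; any?)
open import Data.Product using (Σ; ∃; _×_; _,_; proj₁; proj₂)
open import Data.Sum using (_⊎_; inj₁; inj₂)
open import Data.Empty using (⊥; ⊥-elim)
open import Function using (_∘_; _∘′_)
open import Relation.Nullary using (¬_; Dec; yes; no)
open import Relation.Nullary.Decidable using (_×-dec_; _⊎-dec_)
open import Relation.Binary.PropositionalEquality

⟦_—_⟧ : ℕ → ℕ → EdgeRel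
⟦ a — b ⟧ x y = (a ≡ x × b ≡ y) ⊎ (a ≡ y × b ≡ x)

⟦⟧-flip : ∀ {a b x y} → ⟦ a — b ⟧ x y → ⟦ b — a ⟧ x y
⟦⟧-flip (inj₁ (p , q)) = inj₂ (q , p)
⟦⟧-flip (inj₂ (p , q)) = inj₁ (q , p)

⟦⟧-sym : ∀ {a b x y} → ⟦ a — b ⟧ x y → ⟦ x — y ⟧ a b
⟦⟧-sym (inj₁ (p , q)) = inj₁ (sym p , sym q)
⟦⟧-sym (inj₂ (p , q)) = inj₂ (sym q , sym p)

⟦⟧-trans : ∀ {a b c d x y} → ⟦ a — b ⟧ c d → ⟦ c — d ⟧ x y → ⟦ a — b ⟧ x y
⟦⟧-trans (inj₁ (refl , refl)) e = e
⟦⟧-trans (inj₂ (refl , refl)) e = ⟦⟧-flip e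

⟦_—_⟧? : ∀ a b x y → Dec (⟦ a — b ⟧ x y)
⟦ a — b ⟧? x y = ((a ≟ x) ×-dec (b ≟ y)) ⊎-dec ((a ≟ y) ×-dec (b ≟ x))

infix 4 _⊆E_ _≐E_

_⊆E_ : EdgeRel → EdgeRel → Set
E ⊆E F = ∀ x y → E x y → F x y

_≐E_ : EdgeRel → EdgeRel → Set
E ≐E F = E ⊆E F × F ⊆E E

_∖E_ : EdgeRel → EdgeRel → EdgeRel
(E ∖E F) x y = E x y × ¬ F x y

Disjoint : EdgeRel → EdgeRel → Set
Disjoint E F = ∀ x y → E x y → F x y → ⊥

⟦⟧-comm : ∀ a b → ⟦ a — b ⟧ ≐E ⟦ b — a ⟧
⟦⟧-comm a b = (λ _ _ → ⟦⟧-flip) , (λ _ _ → ⟦⟧-flip)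

≐E-refl : ∀ {E} → E ≐E E
≐E-refl = (λ _ _ e → e) , (λ _ _ e → e)

≐E-trans : ∀ {E F G} → E ≐E F → F ≐E G → E ≐E G
≐E-trans (EF , FE) (FG , GF) = (λ x y → FG x y ∘′ EF x y) , (λ x y → FE x y ∘′ GF x y)

∪E-cong : ∀ {E E' F F'} → E ≐E E' → F ≐E F' → (E ∪E F) ≐E (E' ∪E F')
∪E-cong (EE' , E'E) (FF' , F'F) = cong⊎ EE' FF' , cong⊎ E'E F'F
  where
  cong⊎ : ∀ {E E' F F'} → E ⊆E E' → F ⊆E F' → (E ∪E F) ⊆E (E' ∪E F')
  cong⊎ f g x y (inj₁ e) = inj₁ (f x y e)
  cong⊎ f g x y (inj₂ e) = inj₂ (g x y e)

∖E-cong : ∀ {E E' F F'} → E ≐E E' → F ≐E F' → (E ∖E F) ≐E (E' ∖E F')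
∖E-cong (EE' , E'E) (FF' , F'F) =
  (λ x y (e , ¬f) → EE' x y e , λ f → ¬f (F'F x y f)) ,
  (λ x y (e , ¬f) → E'E x y e , λ f → ¬f (FF' x y f))

∪E-comm : ∀ E F → (E ∪E F) ⊆E (F ∪E E)
∪E-comm E F x y (inj₁ e) = inj₂ e
∪E-comm E F x y (inj₂ f) = inj₁ f

GirthAtLeast-antitone : ∀ {E F g} → F ⊆E E → GirthAtLeast E g → GirthAtLeast F g
GirthAtLeast-antitone F⊆E girth m D D⊆F = girth m D (λ x y d → F⊆E x y (D⊆F x y d))

GirthAtLeast⇒≤ : ∀ {E g l} → GirthAtLeast E g → Σ (Cycle l) (CycleIn E) → g ≤ l
GirthAtLeast⇒≤ girth (D , D⊆E) = girth _ D D⊆E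

swap-decomposes : ∀ {n} {E F : EdgeRel} {v a c : ℕ} (P Q : Path n) → Disjoint E F
  → ⟦ v — a ⟧ ⊆E E → ⟦ v — c ⟧ ⊆E F → c ≢ a → c ≢ v
  → PathEdge P ≐E (⟦ c — v ⟧ ∪E (E ∖E ⟦ v — a ⟧))
  → PathEdge Q ≐E (⟦ a — v ⟧ ∪E (F ∖E ⟦ v — c ⟧))
  → DecomposesInto (E ∪E F) P Q
swap-decomposes {E = E} {F} {v} {a} {c} P Q disj va∈E vc∈F c≢a c≢v (P→ , P←) (Q→ , Q←) =
  covered , P⊆ , Q⊆ , P∩Q
  where
  covered : ∀ x y → (E ∪E F) x y → PathEdge P x y ⊎ PathEdge Q x y
  covered x y (inj₁ e) with ⟦ v — a ⟧? x y
  ... | yes va = inj₂ (Q← x y (inj₁ (⟦⟧-flip va)))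
  ... | no ¬va = inj₁ (P← x y (inj₂ (e , ¬va)))
  covered x y (inj₂ f) with ⟦ v — c ⟧? x y
  ... | yes vc = inj₁ (P← x y (inj₁ (⟦⟧-flip vc)))
  ... | no ¬vc = inj₂ (Q← x y (inj₂ (f , ¬vc)))
  P⊆ : PathEdge P ⊆E (E ∪E F)
  P⊆ x y p with P→ x y p
  ... | inj₁ cv = inj₂ (vc∈F x y (⟦⟧-flip cv))
  ... | inj₂ (e , _) = inj₁ e
  Q⊆ : PathEdge Q ⊆E (E ∪E F)
  Q⊆ x y q with Q→ x y q
  ... | inj₁ av = inj₁ (va∈E x y (⟦⟧-flip av))
  ... | inj₂ (f , _) = inj₂ f
  P∩Q : Disjoint (PathEdge P) (PathEdge Q)
  P∩Q x y p q with P→ x y p | Q→ x y q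
  ... | inj₁ cv | inj₁ av with ⟦⟧-trans cv (⟦⟧-sym av)
  ...   | inj₁ (c≡a , _) = c≢a c≡a
  ...   | inj₂ (c≡v , _) = c≢v c≡v
  P∩Q x y p q | inj₁ cv | inj₂ (_ , ¬vc) = ¬vc (⟦⟧-flip cv)
  P∩Q x y p q | inj₂ (_ , ¬va) | inj₁ av = ¬va (⟦⟧-flip av)
  P∩Q x y p q | inj₂ (e , _) | inj₂ (f , _) = disj x y e f

InjectiveUpTo : (ℕ → ℕ) → ℕ → Set
InjectiveUpTo p l = ∀ {i j} → i ≤ l → j ≤ l → p i ≡ p j → i ≡ j

WalkEdge : (ℕ → ℕ) → ℕ → EdgeRel
WalkEdge p l x y = ∃ λ j → j < l × ⟦ p j — p (suc j) ⟧ x y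

walkPath : (p : ℕ → ℕ) {l : ℕ} → InjectiveUpTo p l → Path l
walkPath p p-inj = record
  { pvtx = λ i → p (toℕ i)
  ; pinj = λ {i} {j} e → toℕ-injective (p-inj (s≤s⁻¹ (toℕ<n i)) (s≤s⁻¹ (toℕ<n j)) e)
  }

walkPath-edges : (p : ℕ → ℕ) {l : ℕ} (p-inj : InjectiveUpTo p l)
  → PathEdge (walkPath p p-inj) ≐E WalkEdge p l
walkPath-edges p p-inj = to , from
  where
  to : PathEdge (walkPath p p-inj) ⊆E WalkEdge p _
  to x y (i , e) = toℕ i , toℕ<n i ,
    subst (λ j → ⟦ p j — p (suc (toℕ i)) ⟧ x y) (toℕ-inject₁ i) e
  from : WalkEdge p _ ⊆E PathEdge (walkPath p p-inj)
  from x y (j , j<l , e) = fromℕ< j<l ,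
    subst₂ (λ i i' → ⟦ p i — p (suc i') ⟧ x y)
      (sym (trans (toℕ-inject₁ (fromℕ< j<l)) (toℕ-fromℕ< j<l))) (sym (toℕ-fromℕ< j<l)) e

infixr 5 _◂_

_◂_ : ℕ → (ℕ → ℕ) → ℕ → ℕ
(x ◂ p) zero = x
(x ◂ p) (suc j) = p j

◂-injective : ∀ {x p l} → (∀ j → p j ≢ x) → InjectiveUpTo p l → InjectiveUpTo (x ◂ p) (suc l)
◂-injective x∉p p-inj {zero}  {zero}  _ _ _ = refl
◂-injective x∉p p-inj {zero}  {suc j} _ _ e = ⊥-elim (x∉p j (sym e))
◂-injective x∉p p-inj {suc i} {zero}  _ _ e = ⊥-elim (x∉p i e)
◂-injective x∉p p-inj {suc i} {suc j} i≤ j≤ e = cong suc (p-inj (s≤s⁻¹ i≤) (s≤s⁻¹ j≤) e)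

◂-edges : ∀ x p l → WalkEdge (x ◂ p) (suc l) ≐E (⟦ x — p 0 ⟧ ∪E WalkEdge p l)
◂-edges x p l = to , from
  where
  to : WalkEdge (x ◂ p) (suc l) ⊆E (⟦ x — p 0 ⟧ ∪E WalkEdge p l)
  to _ _ (zero , _ , e) = inj₁ e
  to _ _ (suc j , j<l , e) = inj₂ (j , s≤s⁻¹ j<l , e)
  from : (⟦ x — p 0 ⟧ ∪E WalkEdge p l) ⊆E WalkEdge (x ◂ p) (suc l)
  from _ _ (inj₁ e) = zero , s≤s z≤n , e
  from _ _ (inj₂ (j , j<l , e)) = suc j , s≤s j<l , e

closedWalk-cycle : ∀ {E} (p : ℕ → ℕ) {l} → 2 ≤ l → InjectiveUpTo p l
  → WalkEdge p l ⊆E E → ⟦ p 0 — p l ⟧ ⊆E E → Σ (Cycle (suc l)) (CycleIn E)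
closedWalk-cycle {E} p {l} 2≤l p-inj walk⊆E closing⊆E = D , D⊆E
  where
  D : Cycle (suc l)
  D = record
    { 3≤n = s≤s 2≤l
    ; vtx = λ i → p (toℕ i)
    ; inj = λ {i} {j} e → toℕ-injective (p-inj (s≤s⁻¹ (toℕ<n i)) (s≤s⁻¹ (toℕ<n j)) e)
    }
  D⊆E : CycleIn E D
  D⊆E x y (i , e) with m≤n⇒m<n∨m≡n (s≤s⁻¹ (toℕ<n i))
  ... | inj₁ i<l = walk⊆E x y (toℕ i , i<l ,
          subst (λ j → ⟦ p (toℕ i) — p j ⟧ x y) (trans (toℕ-fromℕ< _) (m<n⇒m%n≡m (s≤s i<l))) e)
  ... | inj₂ i≡l = closing⊆E x y (⟦⟧-flip (subst₂ (λ j j' → ⟦ p j — p j' ⟧ x y) i≡l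
          (trans (toℕ-fromℕ< _) (trans (cong (λ j → suc j % suc l) i≡l) (n%n≡0 (suc l)))) e))

WalkEdge-reverse : ∀ p l → WalkEdge (λ j → p (l ∸ j)) l ≐E WalkEdge p l
WalkEdge-reverse p l = to , from
  where
  reflect : ∀ {j} → j < l → l ∸ j ≡ suc (l ∸ suc j)
  reflect j<l = +-∸-assoc 1 j<l
  reflect< : ∀ {j} → j < l → l ∸ suc j < l
  reflect< j<l = ∸-monoʳ-< (s≤s z≤n) j<l
  to : WalkEdge (λ j → p (l ∸ j)) l ⊆E WalkEdge p l
  to x y (j , j<l , e) = l ∸ suc j , reflect< j<l ,
    ⟦⟧-flip (subst (λ k → ⟦ p k — p (l ∸ suc j) ⟧ x y) (reflect j<l) e)
  from : WalkEdge p l ⊆E WalkEdge (λ j → p (l ∸ j)) l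
  from x y (i , i<l , e) = l ∸ suc i , reflect< i<l ,
    subst₂ (λ k k' → ⟦ p k — p k' ⟧ x y)
      (sym back) (cong pred (trans (sym back) (reflect (reflect< i<l)))) (⟦⟧-flip e)
    where
    back : l ∸ (l ∸ suc i) ≡ suc i
    back = m∸[m∸n]≡n i<l

reverse-injective : ∀ {p l} → InjectiveUpTo p l → InjectiveUpTo (λ j → p (l ∸ j)) l
reverse-injective {l = l} p-inj {i} {j} i≤l j≤l e =
  ∸-cancelˡ-≡ i≤l j≤l (p-inj (m∸n≤m l i) (m∸n≤m l j) e)

CycleEdge⇒CycleVertex : ∀ {n} (C : Cycle n) {x y} → CycleEdge C x y → CycleVertex C y
CycleEdge⇒CycleVertex C (i , inj₁ (_ , e)) = next i , e
CycleEdge⇒CycleVertex C (i , inj₂ (e , _)) = i , e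

chord-arith : ∀ {m p} → 5 ≤ m → p < m → m ∸ 1 ≤ suc p → m ∸ 1 ≤ suc (suc m ∸ p) → p ≡ 3
chord-arith {suc k} {p} (s≤s 4≤k) (s≤s p≤k) short long = ≤-antisym p≤3 3≤p
  where
  3≤p : 3 ≤ p
  3≤p = s≤s⁻¹ (≤-trans 4≤k short)
  p≤3 : p ≤ 3
  p≤3 = subst (_≤ 3) (m∸[m∸n]≡n p≤k)
          (m≤n+o⇒m∸n≤o k (k ∸ p)
            (subst (k ≤_) (trans (cong suc (+-∸-assoc 2 p≤k)) (+-comm 3 (k ∸ p))) long))

module CyclicSequences (m : ℕ) where

  n : ℕ
  n = suc m

  [m%n+k]%n≡[m+k]%n : ∀ i k → (i % n + k) % n ≡ (i + k) % n
  [m%n+k]%n≡[m+k]%n i k = begin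
    (i % n + k) % n         ≡⟨ %-distribˡ-+ (i % n) k n ⟩
    (i % n % n + k % n) % n ≡⟨ cong (λ j → (j + k % n) % n) (m%n%n≡m%n i n) ⟩
    (i % n + k % n) % n     ≡⟨ sym (%-distribˡ-+ i k n) ⟩
    (i + k) % n             ∎
    where open ≡-Reasoning

  [k+m%n]%n≡[k+m]%n : ∀ k i → (k + i % n) % n ≡ (k + i) % n
  [k+m%n]%n≡[k+m]%n k i = begin
    (k + i % n) % n ≡⟨ cong (_% n) (+-comm k (i % n)) ⟩
    (i % n + k) % n ≡⟨ [m%n+k]%n≡[m+k]%n i k ⟩
    (i + k) % n     ≡⟨ cong (_% n) (+-comm i k) ⟩
    (k + i) % n     ∎
    where open ≡-Reasoning

  [m+[n∸k%n]+k]%n≡m%n : ∀ i r → (i + (n ∸ r % n) + r) % n ≡ i % n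
  [m+[n∸k%n]+k]%n≡m%n i r = begin
    (i + (n ∸ r % n) + r) % n       ≡⟨ sym ([k+m%n]%n≡[k+m]%n (i + (n ∸ r % n)) r) ⟩
    (i + (n ∸ r % n) + r % n) % n   ≡⟨ cong (_% n) (+-assoc i (n ∸ r % n) (r % n)) ⟩
    (i + ((n ∸ r % n) + r % n)) % n ≡⟨ cong (λ j → (i + j) % n) (m∸n+n≡m (m%n≤n r n)) ⟩
    (i + n) % n                     ≡⟨ [m+n]%n≡m%n i n ⟩
    i % n                           ∎
    where open ≡-Reasoning

  +-cancelʳ-% : ∀ i j r → (i + r) % n ≡ (j + r) % n → i % n ≡ j % n
  +-cancelʳ-% i j r eq = begin
    i % n                               ≡⟨ sym (undo i) ⟩
    ((i + r) + (n ∸ r % n)) % n         ≡⟨ sym ([m%n+k]%n≡[m+k]%n (i + r) _) ⟩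
    ((i + r) % n + (n ∸ r % n)) % n     ≡⟨ cong (λ k → (k + (n ∸ r % n)) % n) eq ⟩
    ((j + r) % n + (n ∸ r % n)) % n     ≡⟨ [m%n+k]%n≡[m+k]%n (j + r) _ ⟩
    ((j + r) + (n ∸ r % n)) % n         ≡⟨ undo j ⟩
    j % n                               ∎
    where
    open ≡-Reasoning
    undo : ∀ k → ((k + r) + (n ∸ r % n)) % n ≡ k % n
    undo k = trans
      (cong (_% n) (trans (+-assoc k r _) (trans (cong (k +_) (+-comm r _)) (sym (+-assoc k _ r)))))
      ([m+[n∸k%n]+k]%n≡m%n k r)

  -- A cycle of length n as an n-periodic vertex sequence, injective modulo n;
  -- rotations are then index shifts.
  record CyclicSeq : Set where
    field
      at : ℕ → ℕ
      at-periodic : ∀ j → at j ≡ at (j % n)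
      at-injective-mod : ∀ i j → at i ≡ at j → i % n ≡ j % n
  open CyclicSeq public

  SeqEdge : CyclicSeq → EdgeRel
  SeqEdge A x y = ∃ λ j → ⟦ at A j — at A (suc j) ⟧ x y

  SeqVertex : CyclicSeq → ℕ → Set
  SeqVertex A x = ∃ λ j → at A j ≡ x

  module _ (A : CyclicSeq) where

    at-injective : ∀ {i j} → i < n → j < n → at A i ≡ at A j → i ≡ j
    at-injective {i} {j} i<n j<n e =
      trans (sym (m<n⇒m%n≡m i<n)) (trans (at-injective-mod A i j e) (m<n⇒m%n≡m j<n))

    at-n : at A n ≡ at A 0
    at-n = trans (at-periodic A n) (cong (at A) (n%n≡0 n))

    at-congᵐ : ∀ {i j} → i % n ≡ j % n → at A i ≡ at A j
    at-congᵐ {i} {j} e = trans (at-periodic A i) (trans (cong (at A) e) (sym (at-periodic A j)))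

    SeqVertex-index<n : ∀ {x} → SeqVertex A x → ∃ λ j → j < n × at A j ≡ x
    SeqVertex-index<n (j , e) = j % n , m%n<n j n , trans (sym (at-periodic A j)) e

  rotate : ℕ → CyclicSeq → CyclicSeq
  rotate r A = record
    { at = λ j → at A (j + r)
    ; at-periodic = λ j → at-congᵐ A (sym ([m%n+k]%n≡[m+k]%n j r))
    ; at-injective-mod = λ i j e → +-cancelʳ-% i j r (at-injective-mod A (i + r) (j + r) e)
    }

  module _ (r : ℕ) (A : CyclicSeq) where

    private
      unrotate : ∀ j → at A (j + (n ∸ r % n) + r) ≡ at A j
      unrotate j = at-congᵐ A ([m+[n∸k%n]+k]%n≡m%n j r)

    rotate-edges : SeqEdge (rotate r A) ≐E SeqEdge A
    rotate-edges = (λ _ _ (j , e) → j + r , e)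
                 , (λ x y (j , e) → j + (n ∸ r % n) ,
                      subst₂ (λ u w → ⟦ u — w ⟧ x y) (sym (unrotate j)) (sym (unrotate (suc j))) e)

    rotate-vertex : ∀ {x} → SeqVertex A x → SeqVertex (rotate r A) x
    rotate-vertex (j , e) = j + (n ∸ r % n) , trans (unrotate j) e

    rotate-vertex⁻¹ : ∀ {x} → SeqVertex (rotate r A) x → SeqVertex A x
    rotate-vertex⁻¹ (j , e) = j + r , e

  module _ (A : CyclicSeq) where

    SeqEdge-⊆ : ∀ j {u w} → ⟦ at A j — at A (suc j) ⟧ u w → ⟦ u — w ⟧ ⊆E SeqEdge A
    SeqEdge-⊆ j uw x y e = j , ⟦⟧-trans uw e

    SeqEdge-index<n : ∀ {x y} → SeqEdge A x y → ∃ λ j → j < n × ⟦ at A j — at A (suc j) ⟧ x y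
    SeqEdge-index<n {x} {y} (j , e) = j % n , m%n<n j n ,
      subst₂ (λ u w → ⟦ u — w ⟧ x y) (at-periodic A j) (at-congᵐ A (sym ([k+m%n]%n≡[k+m]%n 1 j))) e

    at-injectiveUpTo : ∀ {l} → l < n → InjectiveUpTo (at A) l
    at-injectiveUpTo l<n i≤l j≤l = at-injective A (≤-<-trans i≤l l<n) (≤-<-trans j≤l l<n)

    WalkEdge⊆SeqEdge : ∀ l → WalkEdge (at A) l ⊆E SeqEdge A
    WalkEdge⊆SeqEdge l _ _ (j , _ , e) = j , e

    forwardArc : ℕ → ℕ
    forwardArc j = at A (suc j)

    backwardArc : ℕ → ℕ
    backwardArc j = forwardArc (m ∸ j)

    forwardArc-injective : InjectiveUpTo forwardArc m
    forwardArc-injective {i} {j} i≤m j≤m e =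
      at-injective (rotate 1 A) (s≤s i≤m) (s≤s j≤m)
        (trans (cong (at A) (+-comm i 1)) (trans e (cong (at A) (+-comm 1 j))))

    forwardArc-edges : 2 ≤ m → WalkEdge forwardArc m ≐E (SeqEdge A ∖E ⟦ at A 0 — at A 1 ⟧)
    forwardArc-edges 2≤m = to , from
      where
      to : WalkEdge forwardArc m ⊆E (SeqEdge A ∖E ⟦ at A 0 — at A 1 ⟧)
      to x y (j , j<m , e) = (suc j , e) , λ e₀ → not-first (⟦⟧-trans e (⟦⟧-sym e₀))
        where
        not-first : ¬ ⟦ at A (suc j) — at A (suc (suc j)) ⟧ (at A 0) (at A 1)
        not-first (inj₁ (e₀ , _)) with at-injective A (s≤s j<m) (s≤s z≤n) e₀
        ... | ()
        not-first (inj₂ (e₁ , e₀)) with at-injective A (s≤s j<m) (s≤s (<⇒≤ 2≤m)) e₁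
        ... | refl with at-injective A (s≤s 2≤m) (s≤s z≤n) e₀
        ... | ()
      from : (SeqEdge A ∖E ⟦ at A 0 — at A 1 ⟧) ⊆E WalkEdge forwardArc m
      from x y (edge , ¬first) with SeqEdge-index<n edge
      ... | zero , _ , e = ⊥-elim (¬first e)
      ... | suc j , j<n , e = j , s≤s⁻¹ j<n , e

    openPath : 2 ≤ m → ∀ {v a x} → ⟦ at A 0 — at A 1 ⟧ v a → ¬ SeqVertex A x
      → Σ (Path n) λ P → PathEdge P ≐E (⟦ x — v ⟧ ∪E (SeqEdge A ∖E ⟦ v — a ⟧))
    openPath 2≤m {x = x} (inj₂ (refl , refl)) x∉A =
      walkPath (x ◂ forwardArc) x◂arc-injective ,
      ≐E-trans (walkPath-edges _ x◂arc-injective)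
        (≐E-trans (◂-edges x forwardArc m)
          (∪E-cong ≐E-refl (≐E-trans (forwardArc-edges 2≤m) (∖E-cong ≐E-refl (⟦⟧-comm _ _)))))
      where
      x◂arc-injective : InjectiveUpTo (x ◂ forwardArc) n
      x◂arc-injective = ◂-injective (λ j e → x∉A (suc j , e)) forwardArc-injective
    openPath 2≤m {x = x} (inj₁ (refl , refl)) x∉A =
      walkPath (x ◂ backwardArc) x◂arc-injective ,
      ≐E-trans (walkPath-edges _ x◂arc-injective)
        (≐E-trans (◂-edges x backwardArc m)
          (∪E-cong (subst (λ v → ⟦ x — at A n ⟧ ≐E ⟦ x — v ⟧) (at-n A) ≐E-refl)
            (≐E-trans (WalkEdge-reverse forwardArc m) (forwardArc-edges 2≤m))))
      where
      x◂arc-injective : InjectiveUpTo (x ◂ backwardArc) n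
      x◂arc-injective = ◂-injective (λ j e → x∉A (suc (m ∸ j) , e)) (reverse-injective forwardArc-injective)

  cyclic : Cycle n → CyclicSeq
  cyclic C = record
    { at = λ j → vtx C (fromℕ< (m%n<n j n))
    ; at-periodic = λ j → cong (vtx C) (fromℕ<-cong _ _ (sym (m%n%n≡m%n j n)) _ _)
    ; at-injective-mod = λ i j e →
        trans (sym (toℕ-fromℕ< (m%n<n i n))) (trans (cong toℕ (inj C e)) (toℕ-fromℕ< (m%n<n j n)))
    }

  module _ (C : Cycle n) where

    vtx≡at : ∀ i → vtx C i ≡ at (cyclic C) (toℕ i)
    vtx≡at i = cong (vtx C) (toℕ-injective (sym (trans (toℕ-fromℕ< _) (m<n⇒m%n≡m (toℕ<n i)))))

    cyclic-edges : SeqEdge (cyclic C) ≐E CycleEdge C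
    cyclic-edges = to , from
      where
      to : SeqEdge (cyclic C) ⊆E CycleEdge C
      to x y (j , e) = i ,
        subst (λ w → ⟦ at (cyclic C) j — w ⟧ x y) (at-congᵐ (cyclic C) {suc j} {suc (toℕ i)} next-index) e
        where
        i : Fin n
        i = fromℕ< (m%n<n j n)
        next-index : suc j % n ≡ suc (toℕ i) % n
        next-index = trans (sym ([k+m%n]%n≡[k+m]%n 1 j)) (cong (λ k → suc k % n) (sym (toℕ-fromℕ< _)))
      from : CycleEdge C ⊆E SeqEdge (cyclic C)
      from x y (i , e) = toℕ i , subst (λ u → ⟦ u — vtx C (next i) ⟧ x y) (vtx≡at i) e

    cycleFrom : ℕ → CyclicSeq
    cycleFrom r = rotate r (cyclic C)

    cycleFrom-edges : ∀ r → SeqEdge (cycleFrom r) ≐E CycleEdge C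
    cycleFrom-edges r = ≐E-trans (rotate-edges r (cyclic C)) cyclic-edges

    cycleFrom-vertex : ∀ r {x} → CycleVertex C x → SeqVertex (cycleFrom r) x
    cycleFrom-vertex r (i , e) = rotate-vertex r (cyclic C) (toℕ i , trans (sym (vtx≡at i)) e)

    cycleFrom-vertex⁻¹ : ∀ r {x} → SeqVertex (cycleFrom r) x → CycleVertex C x
    cycleFrom-vertex⁻¹ r v with rotate-vertex⁻¹ r (cyclic C) v
    ... | j , e = fromℕ< (m%n<n j n) , e

    cycleFrom-root : ∀ i → at (cycleFrom (toℕ i)) 0 ≡ vtx C i
    cycleFrom-root i = sym (vtx≡at i)

    CycleVertex? : ∀ x → Dec (CycleVertex C x)
    CycleVertex? x = any? (λ i → vtx C i ≟ x)

    openCycle : ∀ {v a x} → ⟦ v — a ⟧ ⊆E CycleEdge C → ¬ CycleVertex C x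
      → Σ (Path n) λ P → PathEdge P ≐E (⟦ x — v ⟧ ∪E (CycleEdge C ∖E ⟦ v — a ⟧))
    openCycle va∈C x∉C with proj₂ cyclic-edges _ _ (va∈C _ _ (inj₁ (refl , refl)))
    ... | j , e with openPath (cycleFrom j) (s≤s⁻¹ (3≤n C)) e (x∉C ∘ cycleFrom-vertex⁻¹ j)
    ... | P , P-edges = P , ≐E-trans P-edges (∪E-cong ≐E-refl (∖E-cong (cycleFrom-edges j) ≐E-refl))

  chord-position : ∀ {E} (B : CyclicSeq) {p} → 5 ≤ m → GirthAtLeast E (n ∸ 2) → SeqEdge B ⊆E E
    → ⟦ at B 0 — at B p ⟧ ⊆E (E ∖E SeqEdge B) → 1 ≤ p → p < n → p ≡ 3
  chord-position B {suc zero} _ _ _ chord _ _ =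
    ⊥-elim (proj₂ (chord _ _ (inj₁ (refl , refl))) (0 , inj₁ (refl , refl)))
  chord-position {E} B {suc (suc p)} 5≤m girth B⊆E chord _ p<n with m≤n⇒m<n∨m≡n (s≤s⁻¹ p<n)
  ... | inj₂ refl = ⊥-elim (proj₂ (chord _ _ (inj₁ (refl , refl))) (m , inj₂ (refl , at-n B)))
  ... | inj₁ p<m = chord-arith 5≤m p<m (GirthAtLeast⇒≤ girth short) (GirthAtLeast⇒≤ girth long)
    where
    L = suc (suc p)
    B' = rotate L B
    chord⊆E : ⟦ at B 0 — at B L ⟧ ⊆E E
    chord⊆E x y e = proj₁ (chord x y e)
    wraps : at B' (n ∸ L) ≡ at B 0
    wraps = trans (cong (at B) (m∸n+n≡m (<⇒≤ p<n))) (at-n B)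
    2≤n∸L : 2 ≤ n ∸ L
    2≤n∸L = subst (2 ≤_) (sym (+-∸-assoc 1 (<⇒≤ p<m))) (s≤s (m<n⇒0<n∸m p<m))
    -- The chord closes each of the two arcs of B between B₀ and B_L into a cycle.
    short : Σ (Cycle (suc L)) (CycleIn E)
    short = closedWalk-cycle (at B) (s≤s (s≤s z≤n)) (at-injectiveUpTo B p<n)
              (λ x y e → B⊆E x y (WalkEdge⊆SeqEdge B L x y e)) chord⊆E
    long : Σ (Cycle (suc (n ∸ L))) (CycleIn E)
    long = closedWalk-cycle (at B') 2≤n∸L (at-injectiveUpTo B' (∸-monoʳ-< (s≤s z≤n) (<⇒≤ p<n)))
             (λ x y e → B⊆E x y (proj₁ (rotate-edges L B) x y (WalkEdge⊆SeqEdge B' _ x y e)))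
             (λ x y e → chord⊆E x y (⟦⟧-flip (subst (λ u → ⟦ at B L — u ⟧ x y) wraps e)))

  module SharedRoot {E : EdgeRel} (A B : CyclicSeq) (5≤m : 5 ≤ m) (girth : GirthAtLeast E (n ∸ 2))
    (A⊆E : SeqEdge A ⊆E E) (B⊆E : SeqEdge B ⊆E E) (disj : Disjoint (SeqEdge A) (SeqEdge B))
    (A₀≡B₀ : at A 0 ≡ at B 0) where

    neighbour-position : ∀ {j} → j < n → 0 < j → ⟦ at A 0 — at A j ⟧ ⊆E SeqEdge A
      → ∀ {p} → p < n → at B p ≡ at A j → p ≡ 3
    neighbour-position j<n 0<j _ {zero} _ e with at-injective A j<n (s≤s z≤n) (trans (sym e) (sym A₀≡B₀))
    ... | refl = ⊥-elim (<-irrefl refl 0<j)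
    neighbour-position _ _ A₀Aⱼ∈A {suc p} p<n e = chord-position B 5≤m girth B⊆E chord (s≤s z≤n) p<n
      where
      chord : ⟦ at B 0 — at B (suc p) ⟧ ⊆E (E ∖E SeqEdge B)
      chord x y c with A₀Aⱼ∈A x y (subst₂ (λ u w → ⟦ u — w ⟧ x y) (sym A₀≡B₀) e c)
      ... | edge = A⊆E x y edge , disj x y edge

    shared-neighbour-at-3 : ∀ {j} → j < n → 0 < j → ⟦ at A 0 — at A j ⟧ ⊆E SeqEdge A
      → SeqVertex B (at A j) → at B 3 ≡ at A j
    shared-neighbour-at-3 j<n 0<j A₀Aⱼ∈A Aⱼ∈B with SeqVertex-index<n B Aⱼ∈B
    ... | p , p<n , e = subst (λ k → at B k ≡ _) (neighbour-position j<n 0<j A₀Aⱼ∈A p<n e) e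

    neighbours-not-both-shared : SeqVertex B (at A 1) → SeqVertex B (at A m) → ⊥
    neighbours-not-both-shared A₁∈B Aₘ∈B = <-irrefl 1≡m (≤-trans (s≤s (s≤s z≤n)) 5≤m)
      where
      0<m : 0 < m
      0<m = ≤-trans (s≤s z≤n) 5≤m
      1≡m : 1 ≡ m
      1≡m = at-injective A (s≤s 0<m) ≤-refl (trans
              (sym (shared-neighbour-at-3 (s≤s 0<m) (s≤s z≤n) (SeqEdge-⊆ A 0 (inj₁ (refl , refl))) A₁∈B))
              (shared-neighbour-at-3 ≤-refl 0<m (SeqEdge-⊆ A m (inj₂ (refl , at-n A))) Aₘ∈B))

  private-neighbour : 5 ≤ m → (C C' : Cycle n) → GirthAtLeast (CycleEdge C ∪E CycleEdge C') (n ∸ 2)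
    → Disjoint (CycleEdge C) (CycleEdge C') → ∀ {v} → CycleVertex C v → CycleVertex C' v
    → ∃ λ a → ⟦ v — a ⟧ ⊆E CycleEdge C × ¬ CycleVertex C' a
  private-neighbour 5≤m C C' girth disj (i , refl) (i' , vi'≡v) = choose (CycleVertex? C' (at A 1))
    where
    A = cycleFrom C (toℕ i)
    B = cycleFrom C' (toℕ i')
    A⊆C = proj₁ (cycleFrom-edges C (toℕ i))
    B⊆C' = proj₁ (cycleFrom-edges C' (toℕ i'))
    A₀≡v : at A 0 ≡ vtx C i
    A₀≡v = cycleFrom-root C i
    open SharedRoot A B 5≤m girth (λ x y e → inj₁ (A⊆C x y e)) (λ x y e → inj₂ (B⊆C' x y e))
      (λ x y e e' → disj x y (A⊆C x y e) (B⊆C' x y e'))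
      (trans A₀≡v (sym (trans (cycleFrom-root C' i') vi'≡v)))
    choose : Dec (CycleVertex C' (at A 1)) → ∃ λ a → ⟦ vtx C i — a ⟧ ⊆E CycleEdge C × ¬ CycleVertex C' a
    choose (no A₁∉C') = at A 1 , (λ x y e → A⊆C x y (SeqEdge-⊆ A 0 (inj₁ (A₀≡v , refl)) x y e)) , A₁∉C'
    choose (yes A₁∈C') =
      at A m , (λ x y e → A⊆C x y (SeqEdge-⊆ A m (inj₂ (refl , trans (at-n A) A₀≡v)) x y e)) ,
      λ Aₘ∈C' → neighbours-not-both-shared
                  (cycleFrom-vertex C' (toℕ i') A₁∈C') (cycleFrom-vertex C' (toℕ i') Aₘ∈C')

  two-path-decomposition : 5 ≤ m → (C C' : Cycle n) → Disjoint (CycleEdge C) (CycleEdge C')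
    → (∃ λ v → CycleVertex C v × CycleVertex C' v)
    → GirthAtLeast (CycleEdge C ∪E CycleEdge C') (n ∸ 2)
    → Σ (Path n) λ P → Σ (Path n) λ Q → DecomposesInto (CycleEdge C ∪E CycleEdge C') P Q
  two-path-decomposition 5≤m C C' disj (v , v∈C , v∈C') girth
    with private-neighbour 5≤m C C' girth disj v∈C v∈C'
       | private-neighbour 5≤m C' C (GirthAtLeast-antitone (∪E-comm _ _) girth)
           (λ x y e' e → disj x y e e') v∈C' v∈C
  ... | a , va∈C , a∉C' | c , vc∈C' , c∉C with openCycle C va∈C c∉C | openCycle C' vc∈C' a∉C'
  ... | P , P-edges | Q , Q-edges =
    P , Q , swap-decomposes P Q disj va∈C vc∈C'
      (λ c≡a → c∉C (subst (CycleVertex C) (sym c≡a) a∈C))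
      (λ c≡v → c∉C (subst (CycleVertex C) (sym c≡v) v∈C)) P-edges Q-edges
    where
    a∈C : CycleVertex C a
    a∈C = CycleEdge⇒CycleVertex C (va∈C _ _ (inj₁ (refl , refl)))

lemma3p5 : (k : ℕ) → 3 ≤ k → (C C' : Cycle (2 * k))
    → (∀ x y → CycleEdge C x y → CycleEdge C' x y → ⊥)
    → (∃ λ v → CycleVertex C v × CycleVertex C' v)
    → GirthAtLeast (CycleEdge C ∪E CycleEdge C') (2 * k ∸ 2)
    → Σ (Path (2 * k)) λ P → Σ (Path (2 * k)) λ Q
    → DecomposesInto (CycleEdge C ∪E CycleEdge C') P Q
lemma3p5 k@(suc (suc (suc k′))) (s≤s (s≤s (s≤s _))) =
  CyclicSequences.two-path-decomposition (pred (2 * k)) 5≤2k-1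
  where
  5≤2k-1 : 5 ≤ pred (2 * k)
  5≤2k-1 = s≤s (s≤s (≤-trans (s≤s (s≤s (s≤s z≤n))) (m≤n+m _ k′)))
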